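{- Let $p\ge2$ be an integer and for integers $n\ge0$ put $\beta(n)=\left(n+1-\frac{p}{2}\left\lfloor\frac{n}{p}\right\rfloor\right)\left(\left\lfloor\frac{n}{p}\right\rfloor+1\right)$. Then: (i) for $2\leq k\leq p-1$ and for $k=p+1$, $\sum_{i=0}^{2}\binom{2}{i}(-1)^{i}\beta(k-i)=0$; (ii) $\sum_{i=0}^{2}\binom{2}{i}(-1)^{i}\beta(p-i)=1$; (iii) for $k\geq p+2$, $\sum_{j=0}^{1}\sum_{i=0}^{2}(-1)^{i+j}\binom{2}{i}\beta(k-jp-i)=0$.
   Context: $\lfloor\cdot\rfloor$ denotes the floor function. -}

module Defs where

open import Data.Nat as ℕ using (ℕ; zero; suc; NonZero)
open import Data.Nat.Combinatorics using (_C_)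
open import Data.Integer as ℤ using (ℤ; +_)
open import Data.Rational as ℚ using (ℚ; 0ℚ; 1ℚ; _+_; _*_; _-_; -_)

ι : ℕ → ℚ
ι n = + n ℚ./ 1

sgn : ℕ → ℚ
sgn zero = 1ℚ
sgn (suc i) = - sgn i

Σ[0…_] : ℕ → (ℕ → ℚ) → ℚ
Σ[0… zero ] f = f 0
Σ[0… suc m ] f = Σ[0… m ] f + f (suc m)

β : (p : ℕ) .{{_ : NonZero p}} → ℕ → ℚ
β p n = (ι (suc n) - ((+ p ℚ./ 2) * ι (n ℕ./ p))) * (ι (n ℕ./ p) + 1ℚ)

module Submission where

-- Write n = r + q·p with 0 ≤ r < p.  Then ⌊n/p⌋ = q and β(n) is the
-- polynomial  B(q, r) = (r + 1 + (p/2)·q)(q + 1)  in the block coordinates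
-- (q, r).  A direct computation with B shows that the first difference of
-- β is simply
--     β(n + 1) − β(n) = ⌊(n + 1)/p⌋ + 1        for every n ≥ 0,
-- both inside a block (r + 1 < p) and across a block boundary (r = p − 1).
-- Consequently the second difference is  Δ²β(n + 2) = ⌊(n+2)/p⌋ − ⌊(n+1)/p⌋,
-- which is 1 exactly when p divides n + 2 and 0 otherwise.  Parts (i) and
-- (ii) are read off from this, and since ⌊(a + p)/p⌋ = ⌊a/p⌋ + 1 the second
-- difference is p-periodic from 2 on, which is part (iii).

open import Defs
open import Data.Nat as ℕ using (ℕ; zero; suc; NonZero; _≤_; _<_; _∸_; s≤s; z≤n)
open import Data.Nat.Combinatorics using (_C_)
import Data.Nat.Properties as ℕP
open import Data.Nat.DivMod using (_/_; _%_; m≡m%n+[m/n]*n; m%n<n; m<n⇒m/n≡0;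
  m*n/n≡m; n/n≡1; +-distrib-/-∣ʳ; m/n≡1+[m∸n]/n; /-congˡ)
open import Data.Nat.Divisibility using (n∣m*n)
open import Data.Integer as ℤ using (+_)
import Data.Integer.Properties as ℤP
open import Data.Rational as ℚ using (ℚ; 0ℚ; 1ℚ; _*_; _+_; _-_; toℚᵘ)
open import Data.Rational.Properties using (toℚᵘ-injective; toℚᵘ-fromℚᵘ;
  toℚᵘ-homo-+; toℚᵘ-homo-*; +-inverseʳ)
import Data.Rational.Unnormalised as ℚᵘ
import Data.Rational.Unnormalised.Properties as ℚᵘP
open import Data.Rational.Solver using (module +-*-Solver)
open +-*-Solver
open import Data.Product using (_×_; _,_)
open import Data.Sum using (_⊎_; inj₁; inj₂)
open import Relation.Nullary using (yes; no)
open import Relation.Binary.PropositionalEquality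

toℚᵘ-ι : ∀ n → toℚᵘ (ι n) ℚᵘ.≃ ℚᵘ.mkℚᵘ (+ n) 0
toℚᵘ-ι n = toℚᵘ-fromℚᵘ (ℚᵘ.mkℚᵘ (+ n) 0)

ι-+ : ∀ m n → ι (m ℕ.+ n) ≡ ι m + ι n
ι-+ m n = toℚᵘ-injective (begin
    toℚᵘ (ι (m ℕ.+ n))                ≈⟨ toℚᵘ-ι (m ℕ.+ n) ⟩
    ℚᵘ.mkℚᵘ (+ (m ℕ.+ n)) 0           ≈⟨ ℚᵘ.*≡* numerators ⟩
    ℚᵘ.mkℚᵘ (+ m) 0 ℚᵘ.+ ℚᵘ.mkℚᵘ (+ n) 0
      ≈⟨ ℚᵘP.+-cong (toℚᵘ-ι m) (toℚᵘ-ι n) ⟨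
    toℚᵘ (ι m) ℚᵘ.+ toℚᵘ (ι n)        ≈⟨ toℚᵘ-homo-+ (ι m) (ι n) ⟨
    toℚᵘ (ι m + ι n)                  ∎)
  where
  open ℚᵘP.≃-Reasoning
  numerators : + (m ℕ.+ n) ℤ.* + 1 ≡ (+ m ℤ.* + 1 ℤ.+ + n ℤ.* + 1) ℤ.* + 1
  numerators = trans (ℤP.*-identityʳ _) (sym (trans (ℤP.*-identityʳ _)
    (cong₂ ℤ._+_ (ℤP.*-identityʳ (+ m)) (ℤP.*-identityʳ (+ n)))))

ι-* : ∀ m n → ι (m ℕ.* n) ≡ ι m * ι n
ι-* m n = toℚᵘ-injective (begin
    toℚᵘ (ι (m ℕ.* n))                ≈⟨ toℚᵘ-ι (m ℕ.* n) ⟩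
    ℚᵘ.mkℚᵘ (+ (m ℕ.* n)) 0           ≈⟨ ℚᵘ.*≡* (cong (ℤ._* + 1) (ℤP.pos-* m n)) ⟩
    ℚᵘ.mkℚᵘ (+ m) 0 ℚᵘ.* ℚᵘ.mkℚᵘ (+ n) 0
      ≈⟨ ℚᵘP.*-cong (toℚᵘ-ι m) (toℚᵘ-ι n) ⟨
    toℚᵘ (ι m) ℚᵘ.* toℚᵘ (ι n)        ≈⟨ toℚᵘ-homo-* (ι m) (ι n) ⟨
    toℚᵘ (ι m * ι n)                  ∎)
  where open ℚᵘP.≃-Reasoning

ι-suc : ∀ n → ι (suc n) ≡ 1ℚ + ι n
ι-suc = ι-+ 1

-- p/2 + p/2 = p in ℚ; this is where the half-integer coefficient of β goes.
half+half : ∀ p → (+ p ℚ./ 2) + (+ p ℚ./ 2) ≡ ι p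
half+half p = toℚᵘ-injective (begin
    toℚᵘ (P + P)                      ≈⟨ toℚᵘ-homo-+ P P ⟩
    toℚᵘ P ℚᵘ.+ toℚᵘ P                ≈⟨ ℚᵘP.+-cong halfᵘ halfᵘ ⟩
    ℚᵘ.mkℚᵘ (+ p) 1 ℚᵘ.+ ℚᵘ.mkℚᵘ (+ p) 1 ≈⟨ ℚᵘ.*≡* numerators ⟩
    ℚᵘ.mkℚᵘ (+ p) 0                   ≈⟨ toℚᵘ-ι p ⟨
    toℚᵘ (ι p)                        ∎)
  where
  open ℚᵘP.≃-Reasoning
  P : ℚ
  P = + p ℚ./ 2
  halfᵘ : toℚᵘ P ℚᵘ.≃ ℚᵘ.mkℚᵘ (+ p) 1
  halfᵘ = toℚᵘ-fromℚᵘ (ℚᵘ.mkℚᵘ (+ p) 1)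
  numerators : (+ p ℤ.* + 2 ℤ.+ + p ℤ.* + 2) ℤ.* + 1 ≡ + p ℤ.* (+ 2 ℤ.* + 2)
  numerators = trans (ℤP.*-identityʳ _) (sym (ℤP.*-distribˡ-+ (+ p) (+ 2) (+ 2)))

open ≡-Reasoning

Δ : (ℕ → ℚ) → ℕ → ℚ
Δ f n = f (suc n) - f n

Δ² : (ℕ → ℚ) → ℕ → ℚ
Δ² f k = Σ[0… 2 ] (λ i → ι (2 C i) * sgn i * f (k ∸ i))

Δ²-as-ΔΔ : ∀ f n → Δ² f (suc (suc n)) ≡ Δ f (suc n) - Δ f n
Δ²-as-ΔΔ f n = solve 3
  (λ a b c → con (ι 1) :* con 1ℚ :* a :+ con (ι 2) :* (:- con 1ℚ) :* b
               :+ con (ι 1) :* (:- (:- con 1ℚ)) :* c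
           := (a :- b) :- (b :- c))
  refl (f (suc (suc n))) (f (suc n)) (f n)

mixedSum-as-Δ² : ∀ f p k →
  Σ[0… 1 ] (λ j → Σ[0… 2 ] (λ i → sgn (i ℕ.+ j) * ι (2 C i) * f (k ∸ j ℕ.* p ∸ i)))
    ≡ Δ² f k - Δ² f (k ∸ p)
mixedSum-as-Δ² f p k rewrite ℕP.*-identityˡ p = solve 6
  (λ a b c d e g →
      con 1ℚ :* con (ι 1) :* a :+ (:- con 1ℚ) :* con (ι 2) :* b
        :+ (:- (:- con 1ℚ)) :* con (ι 1) :* c
      :+ ((:- con 1ℚ) :* con (ι 1) :* d :+ (:- (:- con 1ℚ)) :* con (ι 2) :* e
        :+ (:- (:- (:- con 1ℚ))) :* con (ι 1) :* g)
    := (con (ι 1) :* con 1ℚ :* a :+ con (ι 2) :* (:- con 1ℚ) :* b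
          :+ con (ι 1) :* (:- (:- con 1ℚ)) :* c)
       :- (con (ι 1) :* con 1ℚ :* d :+ con (ι 2) :* (:- con 1ℚ) :* e
          :+ con (ι 1) :* (:- (:- con 1ℚ)) :* g))
  refl (f k) (f (k ∸ 1)) (f (k ∸ 2)) (f (k ∸ p)) (f (k ∸ p ∸ 1)) (f (k ∸ p ∸ 2))

block-quotient : ∀ {p} .{{_ : NonZero p}} q r → r < p → (r ℕ.+ q ℕ.* p) / p ≡ q
block-quotient {p} q r r<p = begin
  (r ℕ.+ q ℕ.* p) / p    ≡⟨ +-distrib-/-∣ʳ r (n∣m*n q) ⟩
  r / p ℕ.+ q ℕ.* p / p  ≡⟨ cong₂ ℕ._+_ (m<n⇒m/n≡0 r<p) (m*n/n≡m q p) ⟩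
  q                      ∎

quotient-shift : ∀ {p} .{{_ : NonZero p}} a → (a ℕ.+ p) / p ≡ suc (a / p)
quotient-shift {p} a = begin
  (a ℕ.+ p) / p              ≡⟨ m/n≡1+[m∸n]/n (ℕP.m≤n+m p a) ⟩
  suc ((a ℕ.+ p ∸ p) / p)    ≡⟨ cong suc (/-congˡ (ℕP.m+n∸n≡m a p)) ⟩
  suc (a / p)                ∎

-- β in block coordinates (q, r), with X standing for p/2.
blockForm : ℚ → ℚ → ℚ → ℚ
blockForm X Q R = (R + 1ℚ + X * Q) * (Q + 1ℚ)

blockForm-step : ∀ X Q R → blockForm X Q (1ℚ + R) - blockForm X Q R ≡ Q + 1ℚ
blockForm-step = solve 3
  (λ X Q R → ((con 1ℚ :+ R) :+ con 1ℚ :+ X :* Q) :* (Q :+ con 1ℚ)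
               :- (R :+ con 1ℚ :+ X :* Q) :* (Q :+ con 1ℚ)
           := Q :+ con 1ℚ)
  refl

-- Passing from the last entry r = 2X − 1 of block q to the first entry of
-- block q + 1 raises B by (q + 1) + 1.
blockForm-carry : ∀ X Q →
  blockForm X (1ℚ + Q) 0ℚ - blockForm X Q (X + X - 1ℚ) ≡ (1ℚ + Q) + 1ℚ
blockForm-carry = solve 2
  (λ X Q → (con 0ℚ :+ con 1ℚ :+ X :* (con 1ℚ :+ Q)) :* ((con 1ℚ :+ Q) :+ con 1ℚ)
             :- ((X :+ X :- con 1ℚ) :+ con 1ℚ :+ X :* Q) :* (Q :+ con 1ℚ)
         := (con 1ℚ :+ Q) :+ con 1ℚ)
  refl

β-first-factor : ∀ X Q R →
  (1ℚ + (R + Q * (X + X)) - X * Q) * (Q + 1ℚ) ≡ blockForm X Q R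
β-first-factor = solve 3
  (λ X Q R → (con 1ℚ :+ (R :+ Q :* (X :+ X)) :- X :* Q) :* (Q :+ con 1ℚ)
           := (R :+ con 1ℚ :+ X :* Q) :* (Q :+ con 1ℚ))
  refl

suc-difference : ∀ x y → (1ℚ + x) - (1ℚ + y) ≡ x - y
suc-difference = solve 2
  (λ x y → (con 1ℚ :+ x) :- (con 1ℚ :+ y) := x :- y) refl

-- From here on p = m + 2 is fixed; writing p this way makes p − 1 and p − 2
-- reduce, and supplies the NonZero instance needed by ⌊·/p⌋.
module _ (m : ℕ) where

  private
    p : ℕ
    p = suc (suc m)

    P : ℚ
    P = + p ℚ./ 2

  ι-last-residue : ι (suc m) ≡ P + P - 1ℚ
  ι-last-residue = begin
    ι (suc m)                  ≡⟨ solve 1 (λ x → x := (con 1ℚ :+ x) :- con 1ℚ) refl (ι (suc m)) ⟩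
    (1ℚ + ι (suc m)) - 1ℚ      ≡⟨ cong (_- 1ℚ) (trans (sym (ι-suc (suc m))) (sym (half+half p))) ⟩
    P + P - 1ℚ                 ∎

  β-block : ∀ q r → r < p → β p (r ℕ.+ q ℕ.* p) ≡ blockForm P (ι q) (ι r)
  β-block q r r<p = begin
    β p (r ℕ.+ q ℕ.* p)
      ≡⟨ cong (λ d → (ι (suc (r ℕ.+ q ℕ.* p)) - P * ι d) * (ι d + 1ℚ)) (block-quotient q r r<p) ⟩
    (ι (suc (r ℕ.+ q ℕ.* p)) - P * ι q) * (ι q + 1ℚ)
      ≡⟨ cong (λ x → (x - P * ι q) * (ι q + 1ℚ)) ι-n+1 ⟩
    (1ℚ + (ι r + ι q * (P + P)) - P * ι q) * (ι q + 1ℚ)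
      ≡⟨ β-first-factor P (ι q) (ι r) ⟩
    blockForm P (ι q) (ι r) ∎
    where
    ι-n+1 : ι (suc (r ℕ.+ q ℕ.* p)) ≡ 1ℚ + (ι r + ι q * (P + P))
    ι-n+1 = begin
      ι (suc (r ℕ.+ q ℕ.* p))          ≡⟨ ι-suc (r ℕ.+ q ℕ.* p) ⟩
      1ℚ + ι (r ℕ.+ q ℕ.* p)           ≡⟨ cong (λ x → 1ℚ + x) (ι-+ r (q ℕ.* p)) ⟩
      1ℚ + (ι r + ι (q ℕ.* p))         ≡⟨ cong (λ x → 1ℚ + (ι r + x)) (ι-* q p) ⟩
      1ℚ + (ι r + ι q * ι p)           ≡⟨ cong (λ x → 1ℚ + (ι r + ι q * x)) (half+half p) ⟨
      1ℚ + (ι r + ι q * (P + P))       ∎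

  Δβ-block : ∀ q r → r < p → Δ (β p) (r ℕ.+ q ℕ.* p) ≡ ι (suc (r ℕ.+ q ℕ.* p) / p) + 1ℚ
  Δβ-block q r r<p with r ℕ.≟ suc m
  ... | yes refl = begin
    β p (suc q ℕ.* p) - β p (suc m ℕ.+ q ℕ.* p)
      ≡⟨ cong₂ _-_ (β-block (suc q) 0 (s≤s z≤n)) (β-block q (suc m) r<p) ⟩
    blockForm P (ι (suc q)) 0ℚ - blockForm P (ι q) (ι (suc m))
      ≡⟨ cong₂ (λ Q R → blockForm P Q 0ℚ - blockForm P (ι q) R) (ι-suc q) ι-last-residue ⟩
    blockForm P (1ℚ + ι q) 0ℚ - blockForm P (ι q) (P + P - 1ℚ)
      ≡⟨ blockForm-carry P (ι q) ⟩
    (1ℚ + ι q) + 1ℚ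
      ≡⟨ cong (λ x → x + 1ℚ) (trans (sym (ι-suc q)) (cong ι (sym (block-quotient {p} (suc q) 0 (s≤s z≤n))))) ⟩
    ι (suc q ℕ.* p / p) + 1ℚ ∎
  ... | no r≢p-1 = begin
    β p (suc r ℕ.+ q ℕ.* p) - β p (r ℕ.+ q ℕ.* p)
      ≡⟨ cong₂ _-_ (β-block q (suc r) r+1<p) (β-block q r r<p) ⟩
    blockForm P (ι q) (ι (suc r)) - blockForm P (ι q) (ι r)
      ≡⟨ cong (λ R → blockForm P (ι q) R - blockForm P (ι q) (ι r)) (ι-suc r) ⟩
    blockForm P (ι q) (1ℚ + ι r) - blockForm P (ι q) (ι r)
      ≡⟨ blockForm-step P (ι q) (ι r) ⟩
    ι q + 1ℚ
      ≡⟨ cong (λ x → ι x + 1ℚ) (block-quotient q (suc r) r+1<p) ⟨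
    ι (suc (r ℕ.+ q ℕ.* p) / p) + 1ℚ ∎
    where
    r+1<p : suc r < p
    r+1<p = s≤s (ℕP.≤∧≢⇒< (ℕP.≤-pred r<p) r≢p-1)

  Δβ : ∀ n → Δ (β p) n ≡ ι (suc n / p) + 1ℚ
  Δβ n = subst (λ x → Δ (β p) x ≡ ι (suc x / p) + 1ℚ) (sym (m≡m%n+[m/n]*n n p))
               (Δβ-block (n / p) (n % p) (m%n<n n p))

  Δ²β : ∀ n → Δ² (β p) (suc (suc n)) ≡ ι (suc (suc n) / p) - ι (suc n / p)
  Δ²β n = begin
    Δ² (β p) (suc (suc n))                                ≡⟨ Δ²-as-ΔΔ (β p) n ⟩
    Δ (β p) (suc n) - Δ (β p) n                           ≡⟨ cong₂ _-_ (Δβ (suc n)) (Δβ n) ⟩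
    (ι (suc (suc n) / p) + 1ℚ) - (ι (suc n / p) + 1ℚ)
      ≡⟨ solve 2 (λ x y → (x :+ con 1ℚ) :- (y :+ con 1ℚ) := x :- y) refl (ι (suc (suc n) / p)) (ι (suc n / p)) ⟩
    ι (suc (suc n) / p) - ι (suc n / p)                   ∎

  Δ²β-periodic : ∀ j → 2 ≤ j → Δ² (β p) (j ℕ.+ p) ≡ Δ² (β p) j
  Δ²β-periodic (suc zero) (s≤s ())
  Δ²β-periodic (suc (suc n)) _ = begin
    Δ² (β p) (suc (suc n) ℕ.+ p)                                  ≡⟨ Δ²β (n ℕ.+ p) ⟩
    ι ((suc (suc n) ℕ.+ p) / p) - ι ((suc n ℕ.+ p) / p)
      ≡⟨ cong₂ (λ a b → ι a - ι b) (quotient-shift {p} (suc (suc n))) (quotient-shift {p} (suc n)) ⟩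
    ι (suc (suc (suc n) / p)) - ι (suc (suc n / p))
      ≡⟨ cong₂ _-_ (ι-suc (suc (suc n) / p)) (ι-suc (suc n / p)) ⟩
    (1ℚ + ι (suc (suc n) / p)) - (1ℚ + ι (suc n / p))            ≡⟨ suc-difference (ι (suc (suc n) / p)) (ι (suc n / p)) ⟩
    ι (suc (suc n) / p) - ι (suc n / p)                           ≡⟨ Δ²β n ⟨
    Δ² (β p) (suc (suc n))                                        ∎

  -- Part (i): no multiple of p lies in {k − 1, k} for 2 ≤ k ≤ p − 1, and
  -- both p and p + 1 have quotient 1.
  Δ²β-vanishes : ∀ k → (2 ≤ k × k ≤ p ∸ 1) ⊎ k ≡ suc p → Δ² (β p) k ≡ 0ℚ
  Δ²β-vanishes (suc zero) (inj₁ (s≤s () , _))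
  Δ²β-vanishes (suc (suc n)) (inj₁ (_ , k≤p-1)) = begin
    Δ² (β p) (suc (suc n))                   ≡⟨ Δ²β n ⟩
    ι (suc (suc n) / p) - ι (suc n / p)
      ≡⟨ cong₂ (λ a b → ι a - ι b) (m<n⇒m/n≡0 (s≤s k≤p-1)) (m<n⇒m/n≡0 (ℕP.m<n⇒m<1+n k≤p-1)) ⟩
    ι 0 - ι 0                                ≡⟨⟩
    0ℚ                                       ∎
  Δ²β-vanishes .(suc p) (inj₂ refl) = begin
    Δ² (β p) (suc p)                          ≡⟨ Δ²β (suc m) ⟩
    ι (suc p / p) - ι (p / p)
      ≡⟨ cong₂ (λ a b → ι a - ι b) (trans (quotient-shift {p} 1) (cong suc (m<n⇒m/n≡0 {1} {p} (s≤s (s≤s z≤n))))) (n/n≡1 p) ⟩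
    ι 1 - ι 1                                 ≡⟨⟩
    0ℚ                                        ∎

  -- Part (ii): p is the first positive multiple of p.
  Δ²β-at-p : Δ² (β p) p ≡ 1ℚ
  Δ²β-at-p = begin
    Δ² (β p) p                                ≡⟨ Δ²β m ⟩
    ι (p / p) - ι (suc m / p)                 ≡⟨ cong₂ (λ a b → ι a - ι b) (n/n≡1 p) (m<n⇒m/n≡0 (ℕP.n<1+n (suc m))) ⟩
    ι 1 - ι 0                                 ≡⟨⟩
    1ℚ                                        ∎

  -- Part (iii): by periodicity the second differences at k and k − p agree.
  mixedSum-β-vanishes : ∀ k → p ℕ.+ 2 ≤ k →
    Σ[0… 1 ] (λ j → Σ[0… 2 ] (λ i → sgn (i ℕ.+ j) * ι (2 C i) * β p (k ∸ j ℕ.* p ∸ i))) ≡ 0ℚ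
  mixedSum-β-vanishes k p+2≤k = begin
    Σ[0… 1 ] (λ j → Σ[0… 2 ] (λ i → sgn (i ℕ.+ j) * ι (2 C i) * β p (k ∸ j ℕ.* p ∸ i)))
                                              ≡⟨ mixedSum-as-Δ² (β p) p k ⟩
    Δ² (β p) k - Δ² (β p) (k ∸ p)             ≡⟨ cong (λ x → Δ² (β p) x - Δ² (β p) (k ∸ p)) (ℕP.m∸n+n≡m p≤k) ⟨
    Δ² (β p) (k ∸ p ℕ.+ p) - Δ² (β p) (k ∸ p) ≡⟨ cong (_- Δ² (β p) (k ∸ p)) (Δ²β-periodic (k ∸ p) 2≤k-p) ⟩
    Δ² (β p) (k ∸ p) - Δ² (β p) (k ∸ p)       ≡⟨ +-inverseʳ (Δ² (β p) (k ∸ p)) ⟩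
    0ℚ                                        ∎
    where
    p≤k : p ≤ k
    p≤k = ℕP.≤-trans (ℕP.m≤m+n p 2) p+2≤k
    2≤k-p : 2 ≤ k ∸ p
    2≤k-p = subst (_≤ k ∸ p) (ℕP.m+n∸m≡n p 2) (ℕP.∸-monoˡ-≤ p p+2≤k)

theorem4p3 : (p : ℕ) .{{_ : NonZero p}} → 2 ≤ p →
    ((k : ℕ) → (2 ≤ k × k ≤ p ∸ 1) ⊎ k ≡ ℕ.suc p →
      Σ[0… 2 ] (λ i → ι (2 C i) * sgn i * β p (k ∸ i)) ≡ 0ℚ)
    × (Σ[0… 2 ] (λ i → ι (2 C i) * sgn i * β p (p ∸ i)) ≡ 1ℚ)
    × ((k : ℕ) → p ℕ.+ 2 ≤ k →
      Σ[0… 1 ] (λ j → Σ[0… 2 ] (λ i →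
        sgn (i ℕ.+ j) * ι (2 C i) * β p (k ∸ j ℕ.* p ∸ i))) ≡ 0ℚ)
theorem4p3 .(suc (suc m)) (s≤s (s≤s {n = m} z≤n)) =
  Δ²β-vanishes m , Δ²β-at-p m , mixedSum-β-vanishes m
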